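{- Let $k\ge 2$ and $n\in\mathbb{N}$, and consider a $k$-ary tree with labeled chips $0,1,\dots,k^n-1$ starting at the root. For $w,w'\in S_n$, the stable configurations $\mathcal{C}_{k,n,w}$ and $\mathcal{C}_{k,n,w'}$ are distinct if and only if $w\neq w'$.
   Context: The infinite rooted directed $k$-ary tree has a root on layer $1$; every vertex has $k$ children, ordered left to right, on the next layer. A vertex with at least $k$ chips may fire by choosing $k$ of its labeled chips and sending the $j$th smallest to its $j$th leftmost child. Chips are written in $n$-digit $k$-ary expansion (leading zeros allowed). For $w=w_1\dots w_n\in S_n$, the strategy $F_w$ fires, for each $i\in[n]$, each vertex $v$ on layer $i$ so that all chips on $v$ whose $w_i$th most significant digit equals $j$ go to the $(j+1)$th leftmost child of $v$ ($j=0,\dots,k-1$). $\mathcal{C}_{k,n,w}$ denotes the resulting stable configuration, written as the sequence of chips on layer $n+1$ read left to right. -}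

module Defs where

open import Data.Nat using (ℕ; zero; suc; _∸_; _^_; _≡ᵇ_; NonZero)
open import Data.Nat.DivMod using (_/_; _%_)
open import Data.Nat.Properties using (m^n≢0)
open import Data.Fin using (Fin; toℕ)
open import Data.Fin.Permutation using (Permutation′; _⟨$⟩ʳ_)
open import Data.List using (List; []; _∷_; [_]; map; concatMap; filterᵇ; upTo; allFin)

-- A chip c in [0, k^n) written with n k-ary digits (leading zeros allowed).
-- digit k n p c is the (p+1)-th most significant digit (p : 0-indexed position),
-- i.e. floor(c / k^(n-1-p)) mod k.
digit : (k n : ℕ) .{{_ : NonZero k}} → ℕ → ℕ → ℕ
digit k n p c = (_/_ c (k ^ (n ∸ suc p)) {{m^n≢0 k (n ∸ suc p)}}) % k

-- Chips on one vertex, given as the list of digit positions still to be used on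
-- the layers below it (ps), are sent down by the strategy: at the current vertex,
-- all chips whose digit at position p equals j go to the (j+1)-th leftmost child,
-- j = 0..k-1.  The result lists, for the vertices of the layer reached after
-- all of ps, from left to right, the chips on each vertex (in increasing order).
spread : (k n : ℕ) .{{_ : NonZero k}} → List ℕ → List ℕ → List (List ℕ)
spread k n [] chips = [ chips ]
spread k n (p ∷ ps) chips =
  concatMap (λ j → spread k n ps (filterᵇ (λ c → digit k n p c ≡ᵇ j) chips)) (upTo k)

-- The strategy F_w: on layer i (i = 1..n) use the w_i-th most significant digit.
-- Positions are 0-indexed here, so w_i corresponds to toℕ (w ⟨$⟩ʳ i).
positions : (n : ℕ) → Permutation′ n → List ℕ
positions n w = map (λ i → toℕ (w ⟨$⟩ʳ i)) (allFin n)

-- C_{k,n,w}: the configuration on layer n+1 (the k^n vertices, read left to right,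
-- each with its list of chips), starting with chips 0,...,k^n-1 at the root.
stableConfig : (k n : ℕ) .{{_ : NonZero k}} → Permutation′ n → List (List ℕ)
stableConfig k n w = spread k n (positions n w) (upTo (k ^ n))

{-# OPTIONS --safe #-}
-- Let e_q = k ^ (n ∸ suc q) be the chip whose only nonzero digit is a 1 in
-- position q.  If two strategies fire the root by different positions p ≠ p′,
-- e_p goes to the second child of the root under the first strategy and to the
-- first child under the second.  Firing never creates or destroys chips and all
-- subtrees hanging off one layer have the same number of leaves, so the leaves
-- below the second child are the same block of the final configuration in both
-- cases, and e_p would have to lie in it under both: contradiction.  If the
-- root positions agree, compare the subtrees below the first child, which still
-- hold e_q for every position q not yet used.
module Submission where

open import Defs
open import Data.Nat using (ℕ; suc; _+_; _*_; _∸_; _^_; _≤_; _<_; _≡ᵇ_; NonZero; z≤n; s≤s; _≟_)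
open import Data.Nat.Properties
  using (suc-injective; <-cmp; <-trans; ^-monoʳ-<; ^-distribˡ-+-*; m^n≢0; *-comm; m+[n∸m]≡n;
         ∸-cancelˡ-≡; ∸-monoʳ-<; ≡ᵇ⇒≡; ≡⇒≡ᵇ; 0≢1+n; +-comm)
open import Data.Nat.DivMod using (_/_; _%_; m%n<n; m<n⇒m%n≡m; n/n≡1; m*n/n≡m; m*n%n≡0; m<n⇒m/n≡0)
open import Data.Fin using (toℕ)
open import Data.Fin.Properties using (toℕ-injective; toℕ<n)
open import Data.Fin.Permutation using (Permutation′; _⟨$⟩ʳ_)
open import Data.List using (List; []; _∷_; map; concatMap; filterᵇ; upTo; allFin; length; _++_)
open import Data.List.Properties using (∷-injective; length-++; length-map; length-tabulate; map-cong)
open import Data.List.Relation.Unary.Any as Any using (Any; here; there)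
open import Data.List.Relation.Unary.Any.Properties using (concatMap⁺; concatMap⁻)
open import Data.List.Relation.Unary.All as All using (All; _∷_)
import Data.List.Relation.Unary.All.Properties as All
open import Data.List.Relation.Unary.AllPairs using (_∷_)
open import Data.List.Relation.Unary.Unique.Propositional using (Unique)
import Data.List.Relation.Unary.Unique.Propositional.Properties as Unique
open import Data.List.Membership.Propositional using (_∈_; lose)
open import Data.List.Membership.Propositional.Properties
  using (∈-upTo⁺; ∈-filter⁺; ∈-filter⁻; ∈-allFin)
open import Data.Product using (_×_; _,_; proj₁; proj₂)
open import Relation.Nullary using (¬_; yes; no; contradiction; T?)
open import Relation.Binary.PropositionalEquality
  using (_≡_; _≢_; refl; sym; trans; cong; cong₂; subst; module ≡-Reasoning)
open import Relation.Binary.Definitions using (tri<; tri≈; tri>)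
open import Function.Bundles using (_⇔_; mk⇔; Injection)
open import Function.Properties.Inverse using (↔⇒↣)

module _ {A : Set} where

  ++-injective : (xs xs′ : List A) {ys ys′ : List A} → length xs ≡ length xs′ →
                 xs ++ ys ≡ xs′ ++ ys′ → xs ≡ xs′ × ys ≡ ys′
  ++-injective []       []         _   eq = refl , eq
  ++-injective (x ∷ xs) (x′ ∷ xs′) len eq with refl , eq′ ← ∷-injective eq
    with refl , ys≡ys′ ← ++-injective xs xs′ (suc-injective len) eq′ = refl , ys≡ys′

module _ {A B : Set} where

  length-concatMap-cong : (f g : A → List B) → (∀ j → length (f j) ≡ length (g j)) →
                          ∀ js → length (concatMap f js) ≡ length (concatMap g js)
  length-concatMap-cong f g len []       = refl
  length-concatMap-cong f g len (j ∷ js) = begin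
    length (f j ++ concatMap f js)           ≡⟨ length-++ (f j) ⟩
    length (f j) + length (concatMap f js)   ≡⟨ cong₂ _+_ (len j) (length-concatMap-cong f g len js) ⟩
    length (g j) + length (concatMap g js)   ≡⟨ length-++ (g j) ⟨
    length (g j ++ concatMap g js)           ∎
    where open ≡-Reasoning

  concatMap-blocks-≡ : (f g : A → List B) → (∀ j → length (f j) ≡ length (g j)) →
                       ∀ {js} → concatMap f js ≡ concatMap g js → ∀ {j} → j ∈ js → f j ≡ g j
  concatMap-blocks-≡ f g len {j ∷ _} eq (here refl) = proj₁ (++-injective (f j) (g j) (len j) eq)
  concatMap-blocks-≡ f g len {j ∷ _} eq (there j∈js) =
    concatMap-blocks-≡ f g len (proj₂ (++-injective (f j) (g j) (len j) eq)) j∈js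

  map-cong⁻ : (f g : A → B) {xs : List A} → map f xs ≡ map g xs → ∀ {x} → x ∈ xs → f x ≡ g x
  map-cong⁻ f g {_ ∷ _} eq (here refl)  = proj₁ (∷-injective eq)
  map-cong⁻ f g {_ ∷ _} eq (there x∈xs) = map-cong⁻ f g (proj₂ (∷-injective eq)) x∈xs

module Firing (k n : ℕ) .{{_ : NonZero k}} where

  childChips : ℕ → ℕ → List ℕ → List ℕ
  childChips p j = filterᵇ (λ c → digit k n p c ≡ᵇ j)

  ∈-childChips⁺ : ∀ {p j c X} → c ∈ X → digit k n p c ≡ j → c ∈ childChips p j X
  ∈-childChips⁺ {p} {j} c∈X dig≡j = ∈-filter⁺ (λ c → T? (digit k n p c ≡ᵇ j)) c∈X (≡⇒≡ᵇ _ _ dig≡j)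

  ∈-childChips⁻ : ∀ {p j c} X → c ∈ childChips p j X → c ∈ X × digit k n p c ≡ j
  ∈-childChips⁻ {p} {j} X c∈ with c∈X , eq ← ∈-filter⁻ (λ c′ → T? (digit k n p c′ ≡ᵇ j)) {xs = X} c∈ =
    c∈X , ≡ᵇ⇒≡ _ _ eq

  digit<k : ∀ p c → digit k n p c < k
  digit<k p c = m%n<n _ k

  length-spread : ∀ ps qs {X Y} → length ps ≡ length qs →
                  length (spread k n ps X) ≡ length (spread k n qs Y)
  length-spread []       []       _   = refl
  length-spread (p ∷ ps) (q ∷ qs) len =
    length-concatMap-cong _ _ (λ j → length-spread ps qs (suc-injective len)) (upTo k)

  ∈-spread⁺ : ∀ ps {X c} → c ∈ X → Any (c ∈_) (spread k n ps X)
  ∈-spread⁺ []       c∈X = here c∈X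
  ∈-spread⁺ (p ∷ ps) {c = c} c∈X =
    concatMap⁺ _ (lose (∈-upTo⁺ (digit<k p c)) (∈-spread⁺ ps (∈-childChips⁺ c∈X refl)))

  ∈-spread⁻ : ∀ ps {X c} → Any (c ∈_) (spread k n ps X) → c ∈ X
  ∈-spread⁻ []       (here c∈X) = c∈X
  ∈-spread⁻ (p ∷ ps) {X} c∈
    with _ , c∈child ← Any.satisfied (concatMap⁻ (λ j → spread k n ps (childChips p j X)) {xs = upTo k} c∈)
    = proj₁ (∈-childChips⁻ X (∈-spread⁻ ps c∈child))

  spread-≡⇒⊆ : ∀ ps ps′ {X Y c} → spread k n ps X ≡ spread k n ps′ Y → c ∈ X → c ∈ Y
  spread-≡⇒⊆ ps ps′ eq c∈X = ∈-spread⁻ ps′ (subst (Any (_ ∈_)) eq (∈-spread⁺ ps c∈X))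

  spread-child-≡ : ∀ p ps p′ ps′ {X Y} → length ps ≡ length ps′ →
                   spread k n (p ∷ ps) X ≡ spread k n (p′ ∷ ps′) Y →
                   ∀ {j} → j < k → spread k n ps (childChips p j X) ≡ spread k n ps′ (childChips p′ j Y)
  spread-child-≡ p ps p′ ps′ len eq j<k =
    concatMap-blocks-≡ _ _ (λ j → length-spread ps ps′ len) eq (∈-upTo⁺ j<k)

module UnitChips (k n : ℕ) .{{_ : NonZero k}} (1<k : 1 < k) where

  unitChip : ℕ → ℕ
  unitChip q = k ^ (n ∸ suc q)

  [k^a/k^b]%k≡0 : ∀ a b .{{_ : NonZero (k ^ b)}} → a ≢ b → k ^ a / k ^ b % k ≡ 0
  [k^a/k^b]%k≡0 a b a≢b with <-cmp a b
  ... | tri≈ _ a≡b _ = contradiction a≡b a≢b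
  ... | tri< a<b _ _ = trans (cong (_% k) (m<n⇒m/n≡0 (^-monoʳ-< k 1<k a<b))) (m*n%n≡0 0 k)
  ... | tri> _ _ b<a = begin
    k ^ a / k ^ b % k                    ≡⟨ cong (λ e → k ^ e / k ^ b % k) a≡ ⟩
    (k ^ (suc d + b) / k ^ b) % k        ≡⟨ cong (λ m → m / k ^ b % k) (^-distribˡ-+-* k (suc d) b) ⟩
    (k ^ suc d * k ^ b / k ^ b) % k      ≡⟨ cong (_% k) (m*n/n≡m (k ^ suc d) (k ^ b)) ⟩
    (k * k ^ d) % k                      ≡⟨ cong (_% k) (*-comm k (k ^ d)) ⟩
    (k ^ d * k) % k                      ≡⟨ m*n%n≡0 (k ^ d) k ⟩
    0                                    ∎
    where
    open ≡-Reasoning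
    d : ℕ
    d = a ∸ suc b
    a≡ : a ≡ suc d + b
    a≡ = sym (trans (cong suc (+-comm d b)) (m+[n∸m]≡n b<a))

  digit-unitChip-self : ∀ q → digit k n q (unitChip q) ≡ 1
  digit-unitChip-self q =
    trans (cong (_% k) (n/n≡1 (unitChip q) {{m^n≢0 k (n ∸ suc q)}})) (m<n⇒m%n≡m 1<k)

  digit-unitChip-other : ∀ {q e} → q < n → e < n → q ≢ e → digit k n q (unitChip e) ≡ 0
  digit-unitChip-other {q} {e} q<n e<n q≢e =
    [k^a/k^b]%k≡0 (n ∸ suc e) (n ∸ suc q) {{m^n≢0 k (n ∸ suc q)}}
      (λ eq → q≢e (suc-injective (∸-cancelˡ-≡ q<n e<n (sym eq))))

  unitChip<k^n : ∀ {q} → q < n → unitChip q < k ^ n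
  unitChip<k^n q<n = ^-monoʳ-< k 1<k (∸-monoʳ-< (s≤s z≤n) q<n)

  open Firing k n

  spread-injective : ∀ ps ps′ {A} → length ps ≡ length ps′ → Unique ps →
                     All (_< n) ps → All (_< n) ps′ → All (λ q → unitChip q ∈ A) ps →
                     spread k n ps A ≡ spread k n ps′ A → ps ≡ ps′
  spread-injective []       []         _   _ _ _ _ _ = refl
  spread-injective (p ∷ ps) (p′ ∷ ps′) {A} len (p∉ps ∷ uniq) (p<n ∷ ps<n) (p′<n ∷ ps′<n)
                   (eₚ∈A ∷ es∈A) eq with p ≟ p′
  ... | yes refl =
    cong (p ∷_) (spread-injective ps ps′ len′ uniq ps<n ps′<n es∈child₀
                   (spread-child-≡ p ps p ps′ {A} {A} len′ eq (<-trans (s≤s z≤n) 1<k)))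
    where
    len′ : length ps ≡ length ps′
    len′ = suc-injective len
    es∈child₀ : All (λ q → unitChip q ∈ childChips p 0 A) ps
    es∈child₀ = All.tabulate λ q∈ps →
      ∈-childChips⁺ {p} {0} (All.lookup es∈A q∈ps)
        (digit-unitChip-other p<n (All.lookup ps<n q∈ps) (All.lookup p∉ps q∈ps))
  ... | no p≢p′ = contradiction (trans (sym digit-p′-eₚ≡0) digit-p′-eₚ≡1) 0≢1+n
    where
    eₚ∈child₁ : unitChip p ∈ childChips p 1 A
    eₚ∈child₁ = ∈-childChips⁺ eₚ∈A (digit-unitChip-self p)
    digit-p′-eₚ≡1 : digit k n p′ (unitChip p) ≡ 1
    digit-p′-eₚ≡1 = proj₂ (∈-childChips⁻ A
      (spread-≡⇒⊆ ps ps′ (spread-child-≡ p ps p′ ps′ {A} {A} (suc-injective len) eq 1<k) eₚ∈child₁))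
    digit-p′-eₚ≡0 : digit k n p′ (unitChip p) ≡ 0
    digit-p′-eₚ≡0 = digit-unitChip-other p′<n p<n (λ p′≡p → p≢p′ (sym p′≡p))

module Positions (n : ℕ) where

  length-positions : (w : Permutation′ n) → length (positions n w) ≡ n
  length-positions w = trans (length-map _ (allFin n)) (length-tabulate (λ i → i))

  positions-bounded : (w : Permutation′ n) → All (_< n) (positions n w)
  positions-bounded w = All.map⁺ (All.tabulate⁺ (λ i → toℕ<n (w ⟨$⟩ʳ i)))

  positions-unique : (w : Permutation′ n) → Unique (positions n w)
  positions-unique w =
    Unique.map⁺ (λ eq → Injection.injective (↔⇒↣ w) (toℕ-injective eq)) (Unique.allFin⁺ n)

  positions-cong : {w w′ : Permutation′ n} → (∀ i → w ⟨$⟩ʳ i ≡ w′ ⟨$⟩ʳ i) →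
                   positions n w ≡ positions n w′
  positions-cong w≗w′ = map-cong (λ i → cong toℕ (w≗w′ i)) (allFin n)

  positions-injective : {w w′ : Permutation′ n} → positions n w ≡ positions n w′ →
                        ∀ i → w ⟨$⟩ʳ i ≡ w′ ⟨$⟩ʳ i
  positions-injective eq i = toℕ-injective (map-cong⁻ _ _ eq (∈-allFin i))

corollary3p10 : (k n : ℕ) .{{_ : NonZero k}} → 2 ≤ k → (w w′ : Permutation′ n) →
    (stableConfig k n w ≢ stableConfig k n w′) ⇔ (¬ (∀ i → w ⟨$⟩ʳ i ≡ w′ ⟨$⟩ʳ i))
corollary3p10 k n 1<k w w′ = mk⇔ distinct⇒≢ ≢⇒distinct
  where
  open UnitChips k n 1<k
  open Positions n

  distinct⇒≢ : stableConfig k n w ≢ stableConfig k n w′ → ¬ (∀ i → w ⟨$⟩ʳ i ≡ w′ ⟨$⟩ʳ i)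
  distinct⇒≢ config≢ w≗w′ =
    config≢ (cong (λ ps → spread k n ps (upTo (k ^ n))) (positions-cong {w} {w′} w≗w′))

  ≢⇒distinct : ¬ (∀ i → w ⟨$⟩ʳ i ≡ w′ ⟨$⟩ʳ i) → stableConfig k n w ≢ stableConfig k n w′
  ≢⇒distinct w≢w′ config≡ = w≢w′ (positions-injective {w} {w′}
    (spread-injective (positions n w) (positions n w′)
      (trans (length-positions w) (sym (length-positions w′)))
      (positions-unique w) (positions-bounded w) (positions-bounded w′)
      (All.map (λ q<n → ∈-upTo⁺ (unitChip<k^n q<n)) (positions-bounded w))
      config≡))
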